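{- (Cassini's identity.) For every integer $n \ge 1$, \[ Q^P_{n-1}\,Q^P_{n+1} - (Q^P_n)^2 = (-1)^n\, 2\,(1 + i + 6\varepsilon + 6\,i\varepsilon). \]
   Context: Dual-complex numbers are expressions $x_1 + i\,x_2 + \varepsilon\,y_1 + i\varepsilon\,y_2$ with real coefficients, forming a commutative associative real algebra with basis $\{1,i,\varepsilon,i\varepsilon\}$, where $i^2=-1$, $\varepsilon\ne 0$, $\varepsilon^2=0$, $i\varepsilon=\varepsilon i$, $(i\varepsilon)^2=0$. Pell numbers: $P_0=0$, $P_1=1$, $P_n=2P_{n-1}+P_{n-2}$. The dual-complex Pell quaternion is $Q^P_n = P_n + i\,P_{n+1} + \varepsilon\,P_{n+2} + i\varepsilon\,P_{n+3}$, with products taken in the dual-complex algebra. -}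

module Defs where

open import Data.Nat using (ℕ; zero; suc)
open import Data.Integer using (ℤ; +_; _+_; _*_; _-_; -_)

P : ℕ → ℤ
P zero = + 0
P (suc zero) = + 1
P (suc (suc n)) = + 2 * P (suc n) + P n

-- Dual-complex numbers x1 + i x2 + ε y1 + iε y2 (integer coefficients suffice:
-- all elements in the statement have integer coefficients, and ℤ-coefficient
-- dual-complex numbers form a subring of the real algebra).
record DC : Set where
  constructor dc
  field
    c1 : ℤ
    ci : ℤ
    cε : ℤ
    ciε : ℤ

-- Multiplication with i² = -1, ε² = 0, iε = εi.
_⊗_ : DC → DC → DC
dc a b c d ⊗ dc a' b' c' d' =
  dc (a * a' - b * b')
     (a * b' + b * a')
     (a * c' + c * a' - b * d' - d * b')
     (a * d' + d * a' + b * c' + c * b')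

_⊖_ : DC → DC → DC
dc a b c d ⊖ dc a' b' c' d' = dc (a - a') (b - b') (c - c') (d - d')

_·_ : ℤ → DC → DC
k · dc a b c d = dc (k * a) (k * b) (k * c) (k * d)

sgn : ℕ → ℤ
sgn zero = + 1
sgn (suc n) = - sgn n

QP : ℕ → DC
QP n = dc (P n) (P (suc n)) (P (suc (suc n))) (P (suc (suc (suc n))))

-- The scalar Cassini form C(a, b) = a (2b + a) − b² of two consecutive terms of
-- the Pell recurrence changes sign under one step, so along the Pell numbers it
-- is (−1)ⁿ. Each of the four components of Q_{n−1} Q_{n+1} − Q_n² is a quadratic
-- form in the two initial terms P_{n−1}, P_n, and a direct expansion shows that
-- they are 2, 2, 12, 12 times C(P_{n−1}, P_n).
module Submission where

open import Defs
open import Data.Nat using (ℕ; zero; suc)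
open import Data.Integer using (ℤ; +_; _+_; _*_; _-_; -_)
open import Relation.Binary.PropositionalEquality using (_≡_; refl; cong; module ≡-Reasoning)
open import Data.Integer.Tactic.RingSolver using (solve-∀)

pellStep : ℤ → ℤ → ℤ
pellStep a b = + 2 * b + a

cassiniForm : ℤ → ℤ → ℤ
cassiniForm a b = a * pellStep a b - b * b

-- The ring solver does not unfold definitions, so the identities it proves are
-- stated with pellStep and cassiniForm written out.
cassiniForm-pellStep : ∀ a b → cassiniForm b (pellStep a b) ≡ - cassiniForm a b
cassiniForm-pellStep = expanded
  where
  expanded : ∀ a b → b * (+ 2 * (+ 2 * b + a) + b) - (+ 2 * b + a) * (+ 2 * b + a)
                       ≡ - (a * (+ 2 * b + a) - b * b)
  expanded = solve-∀

P-cassini : ∀ m → cassiniForm (P m) (P (suc m)) ≡ sgn (suc m)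
P-cassini zero = refl
P-cassini (suc m) = begin
  cassiniForm (P (suc m)) (pellStep (P m) (P (suc m))) ≡⟨ cassiniForm-pellStep (P m) (P (suc m)) ⟩
  - cassiniForm (P m) (P (suc m))                       ≡⟨ cong -_ (P-cassini m) ⟩
  - sgn (suc m)                                         ∎
  where open ≡-Reasoning

pellQuaternion : ℤ → ℤ → DC
pellQuaternion a b = dc a b c (pellStep b c)
  where c = pellStep a b

dc-cong : ∀ {a b c d a′ b′ c′ d′} → a ≡ a′ → b ≡ b′ → c ≡ c′ → d ≡ d′ →
          dc a b c d ≡ dc a′ b′ c′ d′
dc-cong refl refl refl refl = refl

pellQuaternion-cassini : ∀ a b → let c = pellStep a b in
  (pellQuaternion a b ⊗ pellQuaternion c (pellStep b c)) ⊖ (pellQuaternion b c ⊗ pellQuaternion b c)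
    ≡ (cassiniForm a b * + 2) · dc (+ 1) (+ 1) (+ 6) (+ 6)
pellQuaternion-cassini a b = dc-cong (real a b) (imaginary a b) (dual a b) (imaginaryDual a b)
  where
  real : ∀ a b → let p2 = + 2 * b + a; p3 = + 2 * p2 + b in
    (a * p2 - b * p3) - (b * b - p2 * p2) ≡ ((a * p2 - b * b) * + 2) * + 1
  real = solve-∀
  imaginary : ∀ a b → let p2 = + 2 * b + a; p3 = + 2 * p2 + b in
    (a * p3 + b * p2) - (b * p2 + p2 * b) ≡ ((a * p2 - b * b) * + 2) * + 1
  imaginary = solve-∀
  dual : ∀ a b → let p2 = + 2 * b + a; p3 = + 2 * p2 + b; p4 = + 2 * p3 + p2; p5 = + 2 * p4 + p3 in
    (a * p4 + p2 * p2 - b * p5 - p3 * p3) - (b * p3 + p3 * b - p2 * p4 - p4 * p2)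
      ≡ ((a * p2 - b * b) * + 2) * + 6
  dual = solve-∀
  imaginaryDual : ∀ a b → let p2 = + 2 * b + a; p3 = + 2 * p2 + b; p4 = + 2 * p3 + p2; p5 = + 2 * p4 + p3 in
    (a * p5 + p3 * p2 + b * p4 + p2 * p3) - (b * p4 + p4 * b + p2 * p3 + p3 * p2)
      ≡ ((a * p2 - b * b) * + 2) * + 6
  imaginaryDual = solve-∀

theorem3p6 : (m : ℕ) → let n = suc m in
    (QP m ⊗ QP (suc n)) ⊖ (QP n ⊗ QP n)
      ≡ (sgn n * + 2) · dc (+ 1) (+ 1) (+ 6) (+ 6)
-- QP n is definitionally pellQuaternion (P n) (P (suc n)), since the Pell
-- recurrence unfolds to pellStep.
theorem3p6 m = begin
  (QP m ⊗ QP (suc (suc m))) ⊖ (QP (suc m) ⊗ QP (suc m))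
    ≡⟨ pellQuaternion-cassini (P m) (P (suc m)) ⟩
  (cassiniForm (P m) (P (suc m)) * + 2) · ω
    ≡⟨ cong (λ s → (s * + 2) · ω) (P-cassini m) ⟩
  (sgn (suc m) * + 2) · ω
    ∎
  where
  open ≡-Reasoning
  ω : DC
  ω = dc (+ 1) (+ 1) (+ 6) (+ 6)
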